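{- For any integer $n\geq2$ and any $1\leq i\leq n-1$, \[ \mathbf{D}_{n,i}(t)=\mathbf{D}_{n,i+1}(t)+(t-1)\,\mathbf{D}_{n-1,i}(t). \]
   Context: $\mathfrak{B}_m$ is the set of signed permutations $\pi_1\cdots\pi_m$ of $[m]$, and $\mathfrak{D}_m\subset\mathfrak{B}_m$ those with an even number of negative entries. For $\pi\in\mathfrak{D}_m$, $\mathrm{Des}_D(\pi)=\{0:\pi_1+\pi_2<0\}\cup\{i\in\{1,\dots,m-1\}:\pi_i>\pi_{i+1}\}$ (for $m=1$ the condition involving $\pi_2$ is void) and $\mathrm{des}_D(\pi)=|\mathrm{Des}_D(\pi)|$. For $j\in\{\pm1,\dots,\pm m\}$, $\mathfrak{D}_{m,j}=\{\pi\in\mathfrak{D}_m:\pi_m=j\}$ and $\mathbf{D}_{m,j}(t)=\sum_{\pi\in\mathfrak{D}_{m,j}}t^{\mathrm{des}_D(\pi)}$. -}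

module Defs where

open import Data.Bool using (Bool; true; false; _∧_; _∨_; not; if_then_else_)
open import Data.Nat as ℕ using (ℕ; zero; suc)
open import Data.Integer as ℤ using (ℤ; +_; -[1+_]; ∣_∣)
open import Data.List using (List; []; _∷_; _++_; map; concatMap; foldr; replicate; upTo)
open import Relation.Nullary.Decidable using (⌊_⌋)
open import Relation.Binary.PropositionalEquality using (_≡_)

-- Polynomials in t with integer coefficients, as coefficient lists
-- (constant term first).  Equality is coefficientwise.

Poly : Set
Poly = List ℤ

coeff : Poly → ℕ → ℤ
coeff []       _       = + 0
coeff (a ∷ p)  zero    = a
coeff (a ∷ p)  (suc k) = coeff p k

_≈ₚ_ : Poly → Poly → Set
p ≈ₚ q = ∀ k → coeff p k ≡ coeff q k

infixl 6 _+ₚ_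
infixl 7 _*ₚ_
infix 4 _≈ₚ_

_+ₚ_ : Poly → Poly → Poly
[]      +ₚ q       = q
(a ∷ p) +ₚ []      = a ∷ p
(a ∷ p) +ₚ (b ∷ q) = (a ℤ.+ b) ∷ (p +ₚ q)

scale : ℤ → Poly → Poly
scale c = map (c ℤ.*_)

_*ₚ_ : Poly → Poly → Poly
[]      *ₚ q = []
(a ∷ p) *ₚ q = scale a q +ₚ (+ 0 ∷ (p *ₚ q))

monomial : ℕ → Poly
monomial k = replicate k (+ 0) ++ (+ 1 ∷ [])

t-1 : Poly
t-1 = ℤ.- (+ 1) ∷ + 1 ∷ []

-- Signed permutations, represented as the word π₁ ⋯ πₘ (a list of ℤ).

letters : ℕ → List ℤ
letters m = map (λ k → + suc k) (upTo m) ++ map (λ k → -[1+ k ]) (upTo m)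

words : ℕ → ℕ → List (List ℤ)
words m zero    = [] ∷ []
words m (suc k) = concatMap (λ x → map (x ∷_) (words m k)) (letters m)

elemℕ : ℕ → List ℕ → Bool
elemℕ x []       = false
elemℕ x (y ∷ ys) = ⌊ x ℕ.≟ y ⌋ ∨ elemℕ x ys

distinct : List ℕ → Bool
distinct []       = true
distinct (x ∷ xs) = not (elemℕ x xs) ∧ distinct xs

-- a word of length m over {±1,…,±m} is a signed permutation of [m]
-- iff the absolute values of its entries are pairwise distinct
isSigned : List ℤ → Bool
isSigned w = distinct (map ∣_∣ w)

isNeg : ℤ → Bool
isNeg (+ _)    = false
isNeg -[1+ _ ] = true

negCount : List ℤ → ℕ
negCount []       = 0
negCount (x ∷ xs) = (if isNeg x then 1 else 0) ℕ.+ negCount xs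

even : ℕ → Bool
even zero          = true
even (suc zero)    = false
even (suc (suc n)) = even n

boolFilter : {A : Set} → (A → Bool) → List A → List A
boolFilter p []       = []
boolFilter p (x ∷ xs) = if p x then x ∷ boolFilter p xs else boolFilter p xs

signedPerms : ℕ → List (List ℤ)
signedPerms m = boolFilter isSigned (words m m)

typeDPerms : ℕ → List (List ℤ)
typeDPerms m = boolFilter (λ w → even (negCount w)) (signedPerms m)

lastIs : ℤ → List ℤ → Bool
lastIs j []           = false
lastIs j (x ∷ [])     = ⌊ x ℤ.≟ j ⌋
lastIs j (x ∷ y ∷ ys) = lastIs j (y ∷ ys)

typeDPermsEnding : ℕ → ℤ → List (List ℤ)
typeDPermsEnding m j = boolFilter (lastIs j) (typeDPerms m)

ascDes : List ℤ → ℕ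
ascDes []           = 0
ascDes (x ∷ [])     = 0
ascDes (x ∷ y ∷ ys) = (if ⌊ y ℤ.<? x ⌋ then 1 else 0) ℕ.+ ascDes (y ∷ ys)

-- contribution of 0 ∈ Des_D(π): π₁ + π₂ < 0 (void when m ≤ 1)
zeroDes : List ℤ → ℕ
zeroDes (x ∷ y ∷ _) = if ⌊ (x ℤ.+ y) ℤ.<? + 0 ⌋ then 1 else 0
zeroDes _           = 0

desD : List ℤ → ℕ
desD w = zeroDes w ℕ.+ ascDes w

Dpoly : ℕ → ℤ → Poly
Dpoly m j = foldr (λ w acc → monomial (desD w) +ₚ acc) [] (typeDPermsEnding m j)

{-# OPTIONS --safe #-}
-- Deleting the final entry i of π ∈ 𝔇_{n,i} and standardising the remaining entries
-- (lowering every absolute value above i by one, keeping signs) is a bijection onto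
-- 𝔇_{n-1}.  Its inverse is an odd, strictly increasing relabelling followed by
-- appending i, so it keeps all comparisons πⱼ > πⱼ₊₁ and π₁ + π₂ < 0 and adds one
-- descent exactly when the standardised word u ends in an entry ≥ i:
--   des_D π = des_D u + [u_{n-1} ≥ i].
-- Hence 𝐃_{n,i} and 𝐃_{n,i+1} differ only on the u ending in i, each of which
-- contributes t^{d+1} - t^d = (t - 1) t^d.  Comparing coefficients of t^k turns this
-- into an identity between numbers of words.
module Submission where

open import Defs
open import Data.Nat using (ℕ; suc; _≤_; _∸_)
open import Data.Integer using (+_)

open import Data.Bool using (Bool; true; false; _∧_; _∨_; not; if_then_else_)
open import Data.Bool.Properties using (∧-zeroʳ; ∨-zeroʳ)
open import Data.Nat as ℕ using (zero; _+_; _<_; _≤?_; _≡ᵇ_; z≤n; s≤s; 2+)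
open import Data.Nat.Properties
  using (+-assoc; +-comm; +-identityʳ; +-commutativeSemigroup; suc-injective;
         ≤-refl; <-irrefl; <⇒≤; ≤∧≢⇒<)
open import Algebra.Properties.CommutativeSemigroup +-commutativeSemigroup using (interchange; x∙yz≈y∙xz)
open import Data.Integer as ℤ using (ℤ; -[1+_]; +[1+_]; ∣_∣; -_; 0ℤ; -1ℤ; +<+; -<+; -<-)
import Data.Integer.Properties as ℤₚ
open import Data.Integer.Tactic.RingSolver using (solve-∀)
open import Data.List using (List; []; _∷_; _++_; [_]; map; concatMap; foldr; applyUpTo)
open import Data.List.Properties using (map-++; map-applyUpTo)
open import Data.List.Relation.Unary.Any using (Any; here; there)
import Data.List.Relation.Unary.Any.Properties as Any
open import Data.Product using (_×_; _,_)
open import Data.Sum using (_⊎_; inj₁; inj₂)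
open import Function using (_∘_; id; _⇔_; mk⇔; Equivalence)
open import Relation.Nullary using (Dec; yes; no; ¬_)
open import Relation.Nullary.Decidable using (⌊_⌋; isYes≗does; dec-true; dec-false; does-⇔)
open import Relation.Binary.PropositionalEquality hiding ([_])
open ≡-Reasoning

module _ {A B : Set} where

  ⌊⌋-⇔ : A ⇔ B → (a? : Dec A) (b? : Dec B) → ⌊ a? ⌋ ≡ ⌊ b? ⌋
  ⌊⌋-⇔ A⇔B a? b? = trans (isYes≗does a?) (trans (does-⇔ A⇔B a? b?) (sym (isYes≗does b?)))

module _ {A : Set} where

  ⌊⌋-true : (a? : Dec A) → A → ⌊ a? ⌋ ≡ true
  ⌊⌋-true a? a = trans (isYes≗does a?) (dec-true a? a)

  ⌊⌋-false : (a? : Dec A) → ¬ A → ⌊ a? ⌋ ≡ false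
  ⌊⌋-false a? ¬a = trans (isYes≗does a?) (dec-false a? ¬a)

𝟙 : Bool → ℕ
𝟙 b = if b then 1 else 0

∑ : {A : Set} → List A → (A → ℕ) → ℕ
∑ []       f = 0
∑ (x ∷ xs) f = f x + ∑ xs f

syntax ∑ xs (λ x → e) = ∑[ x ∈ xs ] e

module _ {A : Set} where

  ∑-cong : ∀ xs {f g : A → ℕ} → (∀ x → f x ≡ g x) → ∑ xs f ≡ ∑ xs g
  ∑-cong []       f≗g = refl
  ∑-cong (x ∷ xs) f≗g = cong₂ _+_ (f≗g x) (∑-cong xs f≗g)

  ∑-zero : ∀ xs {f : A → ℕ} → (∀ x → f x ≡ 0) → ∑ xs f ≡ 0
  ∑-zero []       f≗0 = refl
  ∑-zero (x ∷ xs) f≗0 = cong₂ _+_ (f≗0 x) (∑-zero xs f≗0)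

  ∑-distrib-+ : ∀ xs (f g : A → ℕ) → ∑[ x ∈ xs ] (f x + g x) ≡ ∑ xs f + ∑ xs g
  ∑-distrib-+ []       f g = refl
  ∑-distrib-+ (x ∷ xs) f g =
    trans (cong (λ s → f x + g x + s) (∑-distrib-+ xs f g)) (interchange (f x) (g x) (∑ xs f) (∑ xs g))

  ∑-++ : ∀ xs ys (f : A → ℕ) → ∑ (xs ++ ys) f ≡ ∑ xs f + ∑ ys f
  ∑-++ []       ys f = refl
  ∑-++ (x ∷ xs) ys f =
    trans (cong (λ s → f x + s) (∑-++ xs ys f)) (sym (+-assoc (f x) (∑ xs f) (∑ ys f)))

  ∑-boolFilter : ∀ (P Q : A → Bool) xs → ∑[ x ∈ boolFilter P xs ] 𝟙 (Q x) ≡ ∑[ x ∈ xs ] 𝟙 (P x ∧ Q x)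
  ∑-boolFilter P Q []       = refl
  ∑-boolFilter P Q (x ∷ xs) with P x
  ... | true  = cong (λ s → 𝟙 (Q x) + s) (∑-boolFilter P Q xs)
  ... | false = ∑-boolFilter P Q xs

module _ {A B : Set} where

  ∑-map : ∀ (g : A → B) xs (f : B → ℕ) → ∑ (map g xs) f ≡ ∑[ x ∈ xs ] f (g x)
  ∑-map g []       f = refl
  ∑-map g (x ∷ xs) f = cong (λ s → f (g x) + s) (∑-map g xs f)

  ∑-concatMap : ∀ (g : A → List B) xs (f : B → ℕ) → ∑ (concatMap g xs) f ≡ ∑[ x ∈ xs ] ∑ (g x) f
  ∑-concatMap g []       f = refl
  ∑-concatMap g (x ∷ xs) f =
    trans (∑-++ (g x) (concatMap g xs) f) (cong (λ s → ∑ (g x) f + s) (∑-concatMap g xs f))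

  ∑-comm : ∀ (xs : List A) (ys : List B) (f : A → B → ℕ) →
    ∑[ x ∈ xs ] ∑[ y ∈ ys ] f x y ≡ ∑[ y ∈ ys ] ∑[ x ∈ xs ] f x y
  ∑-comm []       ys f = sym (∑-zero ys (λ _ → refl))
  ∑-comm (x ∷ xs) ys f =
    trans (cong (λ s → ∑ ys (f x) + s) (∑-comm xs ys f))
          (sym (∑-distrib-+ ys (f x) (λ y → ∑[ x ∈ xs ] f x y)))

punchIn : ℕ → ℕ → ℕ
punchIn zero    a       = suc a
punchIn (suc i) zero    = zero
punchIn (suc i) (suc a) = suc (punchIn i a)

punchIn-mono-< : ∀ i {a b} → a < b → punchIn i a < punchIn i b
punchIn-mono-< zero                    a<b       = s≤s a<b
punchIn-mono-< (suc i) {zero}  {suc b} _         = s≤s z≤n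
punchIn-mono-< (suc i) {suc a} {suc b} (s≤s a<b) = s≤s (punchIn-mono-< i a<b)

punchIn-cancel-< : ∀ i {a b} → punchIn i a < punchIn i b → a < b
punchIn-cancel-< zero                    (s≤s h) = h
punchIn-cancel-< (suc i) {zero}  {zero}  ()
punchIn-cancel-< (suc i) {zero}  {suc b} _       = s≤s z≤n
punchIn-cancel-< (suc i) {suc a} {zero}  ()
punchIn-cancel-< (suc i) {suc a} {suc b} (s≤s h) = s≤s (punchIn-cancel-< i h)

punchIn-injective : ∀ i {a b} → punchIn i a ≡ punchIn i b → a ≡ b
punchIn-injective zero                    refl = refl
punchIn-injective (suc i) {zero}  {zero}  _    = refl
punchIn-injective (suc i) {suc a} {suc b} eq   = cong suc (punchIn-injective i (suc-injective eq))

punchInᵢ≢i : ∀ i a → punchIn i a ≢ i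
punchInᵢ≢i (suc i) (suc a) eq = punchInᵢ≢i i a (suc-injective eq)

i<punchIn⇔i≤ : ∀ i a → i < punchIn i a ⇔ i ≤ a
i<punchIn⇔i≤ i a = mk⇔ (to i a) (from i a)
  where
  to : ∀ i a → i < punchIn i a → i ≤ a
  to zero    a       _         = z≤n
  to (suc i) (suc a) (s≤s i<) = s≤s (to i a i<)
  from : ∀ i a → i ≤ a → i < punchIn i a
  from zero    a       _         = s≤s z≤n
  from (suc i) (suc a) (s≤s i≤a) = s≤s (from i a i≤a)

∑-applyUpTo-punchIn : ∀ {A : Set} (f : ℕ → A) (h : A → ℕ) {i m} → i ≤ m →
  ∑ (applyUpTo f (suc m)) h ≡ h (f i) + ∑ (applyUpTo (f ∘ punchIn i) m) h
∑-applyUpTo-punchIn f h {zero}          _         = refl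
∑-applyUpTo-punchIn f h {suc i} {suc m} (s≤s i≤m) =
  trans (cong (λ s → h (f 0) + s) (∑-applyUpTo-punchIn (f ∘ suc) h i≤m))
        (x∙yz≈y∙xz (h (f 0)) (h (f (suc i))) (∑ (applyUpTo (f ∘ suc ∘ punchIn i) m) h))

-- Raises every absolute value ≥ p + 1 by one, vacating the letters ±(p + 1).
signedPunchIn : ℕ → ℤ → ℤ
signedPunchIn p (+ a)    = + punchIn (suc p) a
signedPunchIn p -[1+ a ] = -[1+ punchIn p a ]

signedPunchIn-mono-< : ∀ p {x y} → x ℤ.< y → signedPunchIn p x ℤ.< signedPunchIn p y
signedPunchIn-mono-< p (-<- a<b) = -<- (punchIn-mono-< p a<b)
signedPunchIn-mono-< p -<+       = -<+
signedPunchIn-mono-< p (+<+ a<b) = +<+ (punchIn-mono-< (suc p) a<b)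

signedPunchIn-cancel-< : ∀ p {x y} → signedPunchIn p x ℤ.< signedPunchIn p y → x ℤ.< y
signedPunchIn-cancel-< p { -[1+ _ ]} { -[1+ _ ]} (-<- h) = -<- (punchIn-cancel-< p h)
signedPunchIn-cancel-< p { -[1+ _ ]} {+ _}      -<+     = -<+
signedPunchIn-cancel-< p {+ _}      {+ _}      (+<+ h) = +<+ (punchIn-cancel-< (suc p) h)

signedPunchIn-neg : ∀ p x → signedPunchIn p (- x) ≡ - signedPunchIn p x
signedPunchIn-neg p -[1+ a ]    = refl
signedPunchIn-neg p (+ zero)    = refl
signedPunchIn-neg p (+ (suc a)) = refl

signedPunchIn≢ : ∀ p x → signedPunchIn p x ≢ + suc p
signedPunchIn≢ p (+ a) eq = punchInᵢ≢i (suc p) a (ℤₚ.+-injective eq)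

letters≡ : ∀ m → letters m ≡ applyUpTo +[1+_] m ++ applyUpTo -[1+_] m
letters≡ m = cong₂ _++_ (map-applyUpTo id +[1+_] m) (map-applyUpTo id -[1+_] m)

∑-letters-punchIn : ∀ (h : ℤ → ℕ) {p m} → p ≤ m →
  ∑ (letters (suc m)) h ≡ (h (+ suc p) + h -[1+ p ]) + ∑ (map (signedPunchIn p) (letters m)) h
∑-letters-punchIn h {p} {m} p≤m = begin
  ∑ (letters (suc m)) h
    ≡⟨ cong (λ xs → ∑ xs h) (letters≡ (suc m)) ⟩
  ∑ (applyUpTo +[1+_] (suc m) ++ applyUpTo -[1+_] (suc m)) h
    ≡⟨ ∑-++ (applyUpTo +[1+_] (suc m)) _ h ⟩
  ∑ (applyUpTo +[1+_] (suc m)) h + ∑ (applyUpTo -[1+_] (suc m)) h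
    ≡⟨ cong₂ _+_ (∑-applyUpTo-punchIn +[1+_] h p≤m) (∑-applyUpTo-punchIn -[1+_] h p≤m) ⟩
  (h (+ suc p) + ∑ positives h) + (h -[1+ p ] + ∑ negatives h)
    ≡⟨ interchange (h (+ suc p)) _ _ _ ⟩
  (h (+ suc p) + h -[1+ p ]) + (∑ positives h + ∑ negatives h)
    ≡⟨ cong (λ s → (h (+ suc p) + h -[1+ p ]) + s) (sym (∑-++ positives negatives h)) ⟩
  (h (+ suc p) + h -[1+ p ]) + ∑ (positives ++ negatives) h
    ≡⟨ cong (λ xs → (h (+ suc p) + h -[1+ p ]) + ∑ xs h) (sym map-letters) ⟩
  (h (+ suc p) + h -[1+ p ]) + ∑ (map (signedPunchIn p) (letters m)) h ∎
  where
  positives negatives : List ℤ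
  positives = applyUpTo (+[1+_] ∘ punchIn p) m
  negatives = applyUpTo (-[1+_] ∘ punchIn p) m
  map-letters : map (signedPunchIn p) (letters m) ≡ positives ++ negatives
  map-letters = begin
    map (signedPunchIn p) (letters m)
      ≡⟨ cong (map (signedPunchIn p)) (letters≡ m) ⟩
    map (signedPunchIn p) (applyUpTo +[1+_] m ++ applyUpTo -[1+_] m)
      ≡⟨ map-++ (signedPunchIn p) (applyUpTo +[1+_] m) _ ⟩
    map (signedPunchIn p) (applyUpTo +[1+_] m) ++ map (signedPunchIn p) (applyUpTo -[1+_] m)
      ≡⟨ cong₂ _++_ (map-applyUpTo +[1+_] (signedPunchIn p) m) (map-applyUpTo -[1+_] (signedPunchIn p) m) ⟩
    positives ++ negatives ∎

∑-words-∷ : ∀ m k (f : List ℤ → ℕ) →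
  ∑ (words m (suc k)) f ≡ ∑[ x ∈ letters m ] ∑[ v ∈ words m k ] f (x ∷ v)
∑-words-∷ m k f =
  trans (∑-concatMap _ (letters m) f) (∑-cong (letters m) (λ x → ∑-map (x ∷_) (words m k) f))

∑-words-∷ʳ : ∀ m k (f : List ℤ → ℕ) →
  ∑ (words m (suc k)) f ≡ ∑[ x ∈ letters m ] ∑[ v ∈ words m k ] f (v ++ [ x ])
∑-words-∷ʳ m zero    f = ∑-words-∷ m zero f
∑-words-∷ʳ m (suc k) f = begin
  ∑ (words m (2+ k)) f
    ≡⟨ ∑-words-∷ m (suc k) f ⟩
  ∑[ y ∈ letters m ] ∑[ v ∈ words m (suc k) ] f (y ∷ v)
    ≡⟨ ∑-cong (letters m) (λ y → ∑-words-∷ʳ m k (f ∘ (y ∷_))) ⟩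
  ∑[ y ∈ letters m ] ∑[ x ∈ letters m ] ∑[ u ∈ words m k ] f (y ∷ u ++ [ x ])
    ≡⟨ ∑-comm (letters m) (letters m) (λ y x → ∑[ u ∈ words m k ] f (y ∷ u ++ [ x ])) ⟩
  ∑[ x ∈ letters m ] ∑[ y ∈ letters m ] ∑[ u ∈ words m k ] f (y ∷ u ++ [ x ])
    ≡⟨ ∑-cong (letters m) (λ x → sym (∑-words-∷ m k (λ v → f (v ++ [ x ])))) ⟩
  ∑[ x ∈ letters m ] ∑[ v ∈ words m (suc k) ] f (v ++ [ x ]) ∎

∑-words-avoiding : ∀ {p m} → p ≤ m → ∀ k (f : List ℤ → ℕ) →
  (∀ v → Any (λ x → ∣ x ∣ ≡ suc p) v → f v ≡ 0) →
  ∑ (words (suc m) k) f ≡ ∑[ u ∈ words m k ] f (map (signedPunchIn p) u)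
∑-words-avoiding p≤m zero    f f-avoids = refl
∑-words-avoiding {p} {m} p≤m (suc k) f f-avoids = begin
  ∑ (words (suc m) (suc k)) f
    ≡⟨ ∑-words-∷ (suc m) k f ⟩
  ∑ (letters (suc m)) h
    ≡⟨ ∑-letters-punchIn h p≤m ⟩
  (h (+ suc p) + h -[1+ p ]) + ∑ raised h
    ≡⟨ cong₂ (λ a b → a + b + ∑ raised h) (h-vanishes (+ suc p) refl) (h-vanishes -[1+ p ] refl) ⟩
  ∑ raised h
    ≡⟨ ∑-map (signedPunchIn p) (letters m) h ⟩
  ∑[ x ∈ letters m ] h (signedPunchIn p x)
    ≡⟨ ∑-cong (letters m) (λ x → ∑-words-avoiding p≤m k (f ∘ (signedPunchIn p x ∷_))
                                   (λ v a → f-avoids _ (there a))) ⟩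
  ∑[ x ∈ letters m ] ∑[ u ∈ words m k ] f (map (signedPunchIn p) (x ∷ u))
    ≡⟨ sym (∑-words-∷ m k (f ∘ map (signedPunchIn p))) ⟩
  ∑[ u ∈ words m (suc k) ] f (map (signedPunchIn p) u) ∎
  where
  raised : List ℤ
  raised = map (signedPunchIn p) (letters m)
  h : ℤ → ℕ
  h x = ∑[ v ∈ words (suc m) k ] f (x ∷ v)
  h-vanishes : ∀ x → ∣ x ∣ ≡ suc p → h x ≡ 0
  h-vanishes x ∣x∣≡ = ∑-zero (words (suc m) k) (λ v → f-avoids (x ∷ v) (here ∣x∣≡))

lastIs-∷ʳ : ∀ j v x → lastIs j (v ++ [ x ]) ≡ ⌊ x ℤ.≟ j ⌋
lastIs-∷ʳ j []          x = refl
lastIs-∷ʳ j (y ∷ [])    x = refl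
lastIs-∷ʳ j (y ∷ z ∷ v) x = lastIs-∷ʳ j (z ∷ v) x

elemℕ-∷ʳ-self : ∀ a xs → elemℕ a (xs ++ [ a ]) ≡ true
elemℕ-∷ʳ-self a []       = cong (_∨ false) (⌊⌋-true (a ℕ.≟ a) refl)
elemℕ-∷ʳ-self a (y ∷ xs) = trans (cong (⌊ a ℕ.≟ y ⌋ ∨_) (elemℕ-∷ʳ-self a xs)) (∨-zeroʳ _)

distinct-∷ʳ-repeated : ∀ {a} xs → Any (_≡ a) xs → distinct (xs ++ [ a ]) ≡ false
distinct-∷ʳ-repeated {a} (x ∷ xs) (here refl) rewrite elemℕ-∷ʳ-self a xs = refl
distinct-∷ʳ-repeated     (x ∷ xs) (there rep) rewrite distinct-∷ʳ-repeated xs rep = ∧-zeroʳ _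

isSigned-∷ʳ-repeated : ∀ v {y} → Any (λ x → ∣ x ∣ ≡ ∣ y ∣) v → isSigned (v ++ [ y ]) ≡ false
isSigned-∷ʳ-repeated v {y} rep =
  trans (cong distinct (map-++ ∣_∣ v [ y ])) (distinct-∷ʳ-repeated (map ∣_∣ v) (Any.map⁺ rep))

elemℕ-punchIn : ∀ i a xs → elemℕ (punchIn i a) (map (punchIn i) xs ++ [ i ]) ≡ elemℕ a xs
elemℕ-punchIn i a []       = cong (_∨ false) (⌊⌋-false (punchIn i a ℕ.≟ i) (punchInᵢ≢i i a))
elemℕ-punchIn i a (y ∷ xs) =
  cong₂ _∨_ (⌊⌋-⇔ (mk⇔ (punchIn-injective i) (cong (punchIn i))) _ _) (elemℕ-punchIn i a xs)

distinct-punchIn : ∀ i xs → distinct (map (punchIn i) xs ++ [ i ]) ≡ distinct xs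
distinct-punchIn i []       = refl
distinct-punchIn i (x ∷ xs) = cong₂ (λ a b → not a ∧ b) (elemℕ-punchIn i x xs) (distinct-punchIn i xs)

extend : ℕ → List ℤ → List ℤ
extend p u = map (signedPunchIn p) u ++ [ + suc p ]

∣extend∣ : ∀ p u → map ∣_∣ (extend p u) ≡ map (punchIn (suc p)) (map ∣_∣ u) ++ [ suc p ]
∣extend∣ p []             = refl
∣extend∣ p (+ a ∷ u)      = cong (punchIn (suc p) a ∷_) (∣extend∣ p u)
∣extend∣ p (-[1+ a ] ∷ u) = cong (suc (punchIn p a) ∷_) (∣extend∣ p u)

isSigned-extend : ∀ p u → isSigned (extend p u) ≡ isSigned u
isSigned-extend p u = trans (cong distinct (∣extend∣ p u)) (distinct-punchIn (suc p) (map ∣_∣ u))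

negCount-extend : ∀ p u → negCount (extend p u) ≡ negCount u
negCount-extend p []             = refl
negCount-extend p (+ a ∷ u)      = negCount-extend p u
negCount-extend p (-[1+ a ] ∷ u) = cong suc (negCount-extend p u)

lastIs-extend : ∀ p u → lastIs (+ suc p) (extend p u) ≡ true
lastIs-extend p u =
  trans (lastIs-∷ʳ (+ suc p) (map (signedPunchIn p) u) (+ suc p)) (⌊⌋-true (+ suc p ℤ.≟ + suc p) refl)

atLeast : ℕ → ℤ → Bool
atLeast i (+ a)    = ⌊ i ≤? a ⌋
atLeast i -[1+ _ ] = false

lastAtLeast : ℕ → List ℤ → Bool
lastAtLeast i []           = false
lastAtLeast i (x ∷ [])     = atLeast i x
lastAtLeast i (x ∷ y ∷ ys) = lastAtLeast i (y ∷ ys)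

<-signedPunchIn : ∀ p x y → ⌊ signedPunchIn p y ℤ.<? signedPunchIn p x ⌋ ≡ ⌊ y ℤ.<? x ⌋
<-signedPunchIn p x y = ⌊⌋-⇔ (mk⇔ (signedPunchIn-cancel-< p) (signedPunchIn-mono-< p)) _ _

x+y<0⇒y<-x : ∀ x y → x ℤ.+ y ℤ.< 0ℤ → y ℤ.< - x
x+y<0⇒y<-x x y x+y<0 = subst₂ ℤ._<_ (x+y-x≡y x y) (ℤₚ.+-identityˡ (- x)) (ℤₚ.+-monoˡ-< (- x) x+y<0)
  where
  x+y-x≡y : ∀ x y → x ℤ.+ y ℤ.- x ≡ y
  x+y-x≡y = solve-∀

y<-x⇒x+y<0 : ∀ x y → y ℤ.< - x → x ℤ.+ y ℤ.< 0ℤ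
y<-x⇒x+y<0 x y y<-x = subst (x ℤ.+ y ℤ.<_) (ℤₚ.+-inverseʳ x) (ℤₚ.+-monoʳ-< x y<-x)

-- x + y < 0 ⇔ y < - x, and signedPunchIn p is odd and strictly increasing.
+<0-signedPunchIn : ∀ p x y →
  ⌊ signedPunchIn p x ℤ.+ signedPunchIn p y ℤ.<? 0ℤ ⌋ ≡ ⌊ x ℤ.+ y ℤ.<? 0ℤ ⌋
+<0-signedPunchIn p x y = ⌊⌋-⇔ (mk⇔ reflect preserve) _ _
  where
  reflect : signedPunchIn p x ℤ.+ signedPunchIn p y ℤ.< 0ℤ → x ℤ.+ y ℤ.< 0ℤ
  reflect h = y<-x⇒x+y<0 x y (signedPunchIn-cancel-< p
    (subst (signedPunchIn p y ℤ.<_) (sym (signedPunchIn-neg p x)) (x+y<0⇒y<-x _ _ h)))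
  preserve : x ℤ.+ y ℤ.< 0ℤ → signedPunchIn p x ℤ.+ signedPunchIn p y ℤ.< 0ℤ
  preserve h = y<-x⇒x+y<0 _ _
    (subst (signedPunchIn p y ℤ.<_) (signedPunchIn-neg p x) (signedPunchIn-mono-< p (x+y<0⇒y<-x x y h)))

1+p<-signedPunchIn : ∀ p x → ⌊ + suc p ℤ.<? signedPunchIn p x ⌋ ≡ atLeast (suc p) x
1+p<-signedPunchIn p (+ a)    =
  ⌊⌋-⇔ (mk⇔ (λ { (+<+ h) → Equivalence.to i<punchIn h }) (+<+ ∘ Equivalence.from i<punchIn)) _ _
  where
  i<punchIn = i<punchIn⇔i≤ (suc p) a
1+p<-signedPunchIn p -[1+ a ] = ⌊⌋-false (+ suc p ℤ.<? -[1+ punchIn p a ]) (λ ())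

ascDes-extend : ∀ p x l →
  ascDes (extend p (x ∷ l)) ≡ ascDes (x ∷ l) + 𝟙 (lastAtLeast (suc p) (x ∷ l))
ascDes-extend p x []      = trans (+-identityʳ _) (cong 𝟙 (1+p<-signedPunchIn p x))
ascDes-extend p x (y ∷ l) =
  trans (cong₂ _+_ (cong 𝟙 (<-signedPunchIn p x y)) (ascDes-extend p y l))
        (sym (+-assoc (𝟙 ⌊ y ℤ.<? x ⌋) (ascDes (y ∷ l)) _))

-- Evenness rules out u = -a, where appending p + 1 may create the descent 0.
desD-extend : ∀ p u → even (negCount u) ≡ true →
  desD (extend p u) ≡ desD u + 𝟙 (lastAtLeast (suc p) u)
desD-extend p []             _ = refl
desD-extend p (+ a ∷ [])     _ =
  cong₂ _+_ (cong 𝟙 (⌊⌋-false (signedPunchIn p (+ a) ℤ.+ + suc p ℤ.<? 0ℤ) λ { (+<+ ()) }))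
            (ascDes-extend p (+ a) [])
desD-extend p (-[1+ a ] ∷ []) ()
desD-extend p (x ∷ y ∷ l)    _ =
  trans (cong₂ _+_ (cong 𝟙 (+<0-signedPunchIn p x y)) (ascDes-extend p x (y ∷ l)))
        (sym (+-assoc (zeroDes (x ∷ y ∷ l)) (ascDes (x ∷ y ∷ l)) _))

letter-split : ∀ i x →
  (⌊ x ℤ.≟ + i ⌋ ≡ true × atLeast i x ≡ true × atLeast (suc i) x ≡ false)
  ⊎ (⌊ x ℤ.≟ + i ⌋ ≡ false × atLeast i x ≡ atLeast (suc i) x)
letter-split i -[1+ a ] = inj₂ (⌊⌋-false (-[1+ a ] ℤ.≟ + i) (λ ()) , refl)
letter-split i (+ a) with a ℕ.≟ i
... | yes refl = inj₁ (refl , ⌊⌋-true (a ≤? a) ≤-refl , ⌊⌋-false (suc a ≤? a) (<-irrefl refl))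
... | no a≢i   = inj₂ (refl ,
                       ⌊⌋-⇔ (mk⇔ (λ i≤a → ≤∧≢⇒< i≤a (a≢i ∘ sym)) <⇒≤) (i ≤? a) (suc i ≤? a))

lastLetter-split : ∀ i u →
  (lastIs (+ i) u ≡ true × lastAtLeast i u ≡ true × lastAtLeast (suc i) u ≡ false)
  ⊎ (lastIs (+ i) u ≡ false × lastAtLeast i u ≡ lastAtLeast (suc i) u)
lastLetter-split i []          = inj₂ (refl , refl)
lastLetter-split i (x ∷ [])    = letter-split i x
lastLetter-split i (x ∷ y ∷ u) = lastLetter-split i (y ∷ u)

desD-shift : ∀ i u k →
  𝟙 (desD u + 𝟙 (lastAtLeast i u) ≡ᵇ k) + 𝟙 (lastIs (+ i) u ∧ (desD u ≡ᵇ k))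
    ≡ 𝟙 (desD u + 𝟙 (lastAtLeast (suc i) u) ≡ᵇ k) + 𝟙 (lastIs (+ i) u ∧ (suc (desD u) ≡ᵇ k))
desD-shift i u k with lastLetter-split i u
... | inj₁ (last≡i , ≥i , ≱1+i) rewrite last≡i | ≥i | ≱1+i | +-identityʳ (desD u) | +-comm (desD u) 1 =
  +-comm (𝟙 (suc (desD u) ≡ᵇ k)) (𝟙 (desD u ≡ᵇ k))
... | inj₂ (last≢i , ≥i≡≥1+i) rewrite last≢i | ≥i≡≥1+i = refl

countD : ℕ → (List ℤ → Bool) → ℕ
countD m Q = ∑[ w ∈ words m m ] 𝟙 (isSigned w ∧ (even (negCount w) ∧ Q w))

-- the coefficient of t^k in Σ_{π ∈ 𝔇_{m,j}} t^{s π}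
countDEnding : ℕ → ℤ → (List ℤ → ℕ) → ℕ → ℕ
countDEnding m j s k = countD m (λ w → lastIs j w ∧ (s w ≡ᵇ k))

countD-cong : ∀ m {Q Q′ : List ℤ → Bool} → (∀ w → even (negCount w) ≡ true → Q w ≡ Q′ w) →
  countD m Q ≡ countD m Q′
countD-cong m {Q} {Q′} Q≗Q′ = ∑-cong (words m m) (λ w → cong 𝟙 (cong (isSigned w ∧_) (guarded w)))
  where
  guarded : ∀ w → even (negCount w) ∧ Q w ≡ even (negCount w) ∧ Q′ w
  guarded w with even (negCount w) in ev
  ... | true  = Q≗Q′ w ev
  ... | false = refl

countD-+-cong : ∀ m {Q₁ Q₂ Q₃ Q₄ : List ℤ → Bool} →
  (∀ w → 𝟙 (Q₁ w) + 𝟙 (Q₂ w) ≡ 𝟙 (Q₃ w) + 𝟙 (Q₄ w)) →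
  countD m Q₁ + countD m Q₂ ≡ countD m Q₃ + countD m Q₄
countD-+-cong m {Q₁} {Q₂} {Q₃} {Q₄} balanced = begin
  countD m Q₁ + countD m Q₂
    ≡⟨ sym (∑-distrib-+ (words m m) (weight Q₁) (weight Q₂)) ⟩
  ∑[ w ∈ words m m ] (weight Q₁ w + weight Q₂ w)
    ≡⟨ ∑-cong (words m m) (λ w → guard (isSigned w) (guard (even (negCount w)) (balanced w))) ⟩
  ∑[ w ∈ words m m ] (weight Q₃ w + weight Q₄ w)
    ≡⟨ ∑-distrib-+ (words m m) (weight Q₃) (weight Q₄) ⟩
  countD m Q₃ + countD m Q₄ ∎
  where
  weight : (List ℤ → Bool) → List ℤ → ℕ
  weight Q w = 𝟙 (isSigned w ∧ (even (negCount w) ∧ Q w))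
  guard : ∀ b {x y z t} → 𝟙 x + 𝟙 y ≡ 𝟙 z + 𝟙 t →
          𝟙 (b ∧ x) + 𝟙 (b ∧ y) ≡ 𝟙 (b ∧ z) + 𝟙 (b ∧ t)
  guard true  eq = eq
  guard false _  = refl

-- Splitting off the last letter, only + (p + 1) contributes; the signed words before
-- it avoid ±(p + 1), so they are exactly the images of words over a smaller alphabet.
countD-lastIs : ∀ {p m} → p ≤ m → ∀ Q →
  countD (suc m) (λ π → lastIs (+ suc p) π ∧ Q π) ≡ countD m (Q ∘ extend p)
countD-lastIs {p} {m} p≤m Q = begin
  ∑ (words (suc m) (suc m)) weight
    ≡⟨ ∑-words-∷ʳ (suc m) m weight ⟩
  ∑ (letters (suc m)) h
    ≡⟨ ∑-letters-punchIn h p≤m ⟩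
  (h (+ suc p) + h -[1+ p ]) + ∑ (map (signedPunchIn p) (letters m)) h
    ≡⟨ cong₂ (λ a b → h (+ suc p) + a + b)
             (h-vanishes -[1+ p ] (⌊⌋-false (-[1+ p ] ℤ.≟ + suc p) (λ ()))) others-vanish ⟩
  h (+ suc p) + 0 + 0
    ≡⟨ trans (+-identityʳ _) (+-identityʳ _) ⟩
  h (+ suc p)
    ≡⟨ ∑-words-avoiding p≤m m (weight ∘ (_++ [ + suc p ]))
                         (λ v rep → weight-unsigned (v ++ [ + suc p ]) (isSigned-∷ʳ-repeated v rep)) ⟩
  ∑[ u ∈ words m m ] weight (extend p u)
    ≡⟨ ∑-cong (words m m) weight-extend ⟩
  countD m (Q ∘ extend p) ∎
  where
  weight : List ℤ → ℕ
  weight w = 𝟙 (isSigned w ∧ (even (negCount w) ∧ (lastIs (+ suc p) w ∧ Q w)))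
  h : ℤ → ℕ
  h x = ∑[ v ∈ words (suc m) m ] weight (v ++ [ x ])
  weight-unsigned : ∀ w → isSigned w ≡ false → weight w ≡ 0
  weight-unsigned w unsigned rewrite unsigned = refl
  weight-extend : ∀ u → weight (extend p u) ≡ 𝟙 (isSigned u ∧ (even (negCount u) ∧ Q (extend p u)))
  weight-extend u rewrite isSigned-extend p u | negCount-extend p u | lastIs-extend p u = refl
  h-vanishes : ∀ x → ⌊ x ℤ.≟ + suc p ⌋ ≡ false → h x ≡ 0
  h-vanishes x x≢ = ∑-zero (words (suc m) m) λ v → vanishes (v ++ [ x ]) (trans (lastIs-∷ʳ _ v x) x≢)
    where
    vanishes : ∀ w → lastIs (+ suc p) w ≡ false → weight w ≡ 0
    vanishes w last≢ rewrite last≢ | ∧-zeroʳ (even (negCount w)) | ∧-zeroʳ (isSigned w) = refl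
  others-vanish : ∑ (map (signedPunchIn p) (letters m)) h ≡ 0
  others-vanish = trans (∑-map (signedPunchIn p) (letters m) h)
    (∑-zero (letters m) λ x → h-vanishes (signedPunchIn p x) (⌊⌋-false _ (signedPunchIn≢ p x)))

countDEnding-desD : ∀ {p m} → p ≤ m → ∀ k →
  countDEnding (suc m) (+ suc p) desD k ≡ countD m (λ u → desD u + 𝟙 (lastAtLeast (suc p) u) ≡ᵇ k)
countDEnding-desD {p} {m} p≤m k = trans (countD-lastIs p≤m (λ π → desD π ≡ᵇ k))
  (countD-cong m (λ u ev → cong (_≡ᵇ k) (desD-extend p u ev)))

countDEnding-recurrence : ∀ {p n} → p < n → ∀ k →
  countDEnding (suc n) (+ suc p) desD k + countDEnding n (+ suc p) desD k
    ≡ countDEnding (suc n) (+ 2+ p) desD k + countDEnding n (+ suc p) (suc ∘ desD) k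
countDEnding-recurrence {p} {n} p<n k = begin
  countDEnding (suc n) (+ suc p) desD k + countDEnding n (+ suc p) desD k
    ≡⟨ cong (_+ countDEnding n (+ suc p) desD k) (countDEnding-desD (<⇒≤ p<n) k) ⟩
  countD n (λ u → desD u + 𝟙 (lastAtLeast (suc p) u) ≡ᵇ k) + countDEnding n (+ suc p) desD k
    ≡⟨ countD-+-cong n (λ u → desD-shift (suc p) u k) ⟩
  countD n (λ u → desD u + 𝟙 (lastAtLeast (2+ p) u) ≡ᵇ k) + countDEnding n (+ suc p) (suc ∘ desD) k
    ≡⟨ cong (_+ countDEnding n (+ suc p) (suc ∘ desD) k) (sym (countDEnding-desD p<n k)) ⟩
  countDEnding (suc n) (+ 2+ p) desD k + countDEnding n (+ suc p) (suc ∘ desD) k ∎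

genPoly : {A : Set} → (A → ℕ) → List A → Poly
genPoly s = foldr (λ w acc → monomial (s w) +ₚ acc) []

coeff-+ₚ : ∀ p q k → coeff (p +ₚ q) k ≡ coeff p k ℤ.+ coeff q k
coeff-+ₚ []      q       k       = sym (ℤₚ.+-identityˡ _)
coeff-+ₚ (a ∷ p) []      k       = sym (ℤₚ.+-identityʳ _)
coeff-+ₚ (a ∷ p) (b ∷ q) zero    = refl
coeff-+ₚ (a ∷ p) (b ∷ q) (suc k) = coeff-+ₚ p q k

coeff-scale : ∀ c p k → coeff (scale c p) k ≡ c ℤ.* coeff p k
coeff-scale c []      k       = sym (ℤₚ.*-zeroʳ c)
coeff-scale c (a ∷ p) zero    = refl
coeff-scale c (a ∷ p) (suc k) = coeff-scale c p k

coeff-monomial : ∀ d k → coeff (monomial d) k ≡ + 𝟙 (d ≡ᵇ k)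
coeff-monomial zero    zero    = refl
coeff-monomial zero    (suc k) = refl
coeff-monomial (suc d) zero    = refl
coeff-monomial (suc d) (suc k) = coeff-monomial d k

coeff-genPoly : ∀ {A : Set} (s : A → ℕ) xs k → coeff (genPoly s xs) k ≡ + ∑[ x ∈ xs ] 𝟙 (s x ≡ᵇ k)
coeff-genPoly s []       k = refl
coeff-genPoly s (x ∷ xs) k = trans (coeff-+ₚ (monomial (s x)) (genPoly s xs) k)
  (cong₂ ℤ._+_ (coeff-monomial (s x) k) (coeff-genPoly s xs k))

coeff-t*genPoly : ∀ {A : Set} (s : A → ℕ) xs k →
  coeff (+ 0 ∷ genPoly s xs) k ≡ + ∑[ x ∈ xs ] 𝟙 (suc (s x) ≡ᵇ k)
coeff-t*genPoly s xs zero    = cong +_ (sym (∑-zero xs (λ _ → refl)))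
coeff-t*genPoly s xs (suc k) = coeff-genPoly s xs k

coeff-t-1*ₚ : ∀ q k → coeff (t-1 *ₚ q) k ≡ coeff (+ 0 ∷ q) k ℤ.- coeff q k
coeff-t-1*ₚ q k = begin
  coeff (t-1 *ₚ q) k
    ≡⟨ coeff-+ₚ (scale -1ℤ q) (+ 0 ∷ (+ 1 ∷ []) *ₚ q) k ⟩
  coeff (scale -1ℤ q) k ℤ.+ coeff (+ 0 ∷ (+ 1 ∷ []) *ₚ q) k
    ≡⟨ cong₂ ℤ._+_ (trans (coeff-scale -1ℤ q k) (ℤₚ.-1*i≡-i (coeff q k))) (coeff-t*1*ₚ k) ⟩
  - coeff q k ℤ.+ coeff (+ 0 ∷ q) k
    ≡⟨ ℤₚ.+-comm (- coeff q k) (coeff (+ 0 ∷ q) k) ⟩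
  coeff (+ 0 ∷ q) k ℤ.- coeff q k ∎
  where
  coeff-[0] : ∀ k → coeff (+ 0 ∷ []) k ≡ 0ℤ
  coeff-[0] zero    = refl
  coeff-[0] (suc k) = refl
  coeff-1*ₚ : ∀ k → coeff ((+ 1 ∷ []) *ₚ q) k ≡ coeff q k
  coeff-1*ₚ k = begin
    coeff (scale (+ 1) q +ₚ (+ 0 ∷ [])) k
      ≡⟨ coeff-+ₚ (scale (+ 1) q) (+ 0 ∷ []) k ⟩
    coeff (scale (+ 1) q) k ℤ.+ coeff (+ 0 ∷ []) k
      ≡⟨ cong₂ ℤ._+_ (trans (coeff-scale (+ 1) q k) (ℤₚ.*-identityˡ (coeff q k))) (coeff-[0] k) ⟩
    coeff q k ℤ.+ 0ℤ
      ≡⟨ ℤₚ.+-identityʳ (coeff q k) ⟩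
    coeff q k ∎
  coeff-t*1*ₚ : ∀ k → coeff (+ 0 ∷ (+ 1 ∷ []) *ₚ q) k ≡ coeff (+ 0 ∷ q) k
  coeff-t*1*ₚ zero    = refl
  coeff-t*1*ₚ (suc k) = coeff-1*ₚ k

∑-typeDPermsEnding : ∀ m j (Q : List ℤ → Bool) →
  ∑[ w ∈ typeDPermsEnding m j ] 𝟙 (Q w) ≡ countD m (λ w → lastIs j w ∧ Q w)
∑-typeDPermsEnding m j Q = trans (∑-boolFilter (lastIs j) Q (typeDPerms m))
  (trans (∑-boolFilter (λ w → even (negCount w)) _ (signedPerms m)) (∑-boolFilter isSigned _ (words m m)))

coeff-Dpoly : ∀ m j k → coeff (Dpoly m j) k ≡ + countDEnding m j desD k
coeff-Dpoly m j k = trans (coeff-genPoly desD (typeDPermsEnding m j) k)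
  (cong +_ (∑-typeDPermsEnding m j (λ w → desD w ≡ᵇ k)))

coeff-t-1*Dpoly : ∀ m j k →
  coeff (t-1 *ₚ Dpoly m j) k ≡ + countDEnding m j (suc ∘ desD) k ℤ.- + countDEnding m j desD k
coeff-t-1*Dpoly m j k = trans (coeff-t-1*ₚ (Dpoly m j) k) (cong₂ ℤ._-_ coeff-t*Dpoly (coeff-Dpoly m j k))
  where
  coeff-t*Dpoly : coeff (+ 0 ∷ Dpoly m j) k ≡ + countDEnding m j (suc ∘ desD) k
  coeff-t*Dpoly = trans (coeff-t*genPoly desD (typeDPermsEnding m j) k)
    (cong +_ (∑-typeDPermsEnding m j (λ w → suc (desD w) ≡ᵇ k)))

m+n≡o+p⇒m≡o+[p-n] : ∀ {m n o p} → m + n ≡ o + p → + m ≡ + o ℤ.+ (+ p ℤ.- + n)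
m+n≡o+p⇒m≡o+[p-n] {m} {n} {o} {p} eq = begin
  + m                        ≡⟨ a≡a+b-b (+ m) (+ n) ⟩
  + (m + n) ℤ.- + n          ≡⟨ cong (λ s → + s ℤ.- + n) eq ⟩
  + (o + p) ℤ.- + n          ≡⟨ ℤₚ.+-assoc (+ o) (+ p) (- + n) ⟩
  + o ℤ.+ (+ p ℤ.- + n)      ∎
  where
  a≡a+b-b : ∀ a b → a ≡ a ℤ.+ b ℤ.- b
  a≡a+b-b = solve-∀

proposition3p7 : (n : ℕ) → 2 ≤ n → (i : ℕ) → 1 ≤ i → i ≤ n ∸ 1 →
    Dpoly n (+ i) ≈ₚ Dpoly n (+ suc i) +ₚ t-1 *ₚ Dpoly (n ∸ 1) (+ i)
proposition3p7 (2+ m) (s≤s (s≤s z≤n)) (suc p) (s≤s z≤n) p<1+m k = begin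
  coeff (Dpoly (2+ m) (+ suc p)) k
    ≡⟨ coeff-Dpoly (2+ m) (+ suc p) k ⟩
  + countDEnding (2+ m) (+ suc p) desD k
    ≡⟨ m+n≡o+p⇒m≡o+[p-n] (countDEnding-recurrence p<1+m k) ⟩
  + countDEnding (2+ m) (+ 2+ p) desD k
    ℤ.+ (+ countDEnding (suc m) (+ suc p) (suc ∘ desD) k ℤ.- + countDEnding (suc m) (+ suc p) desD k)
    ≡⟨ sym (cong₂ ℤ._+_ (coeff-Dpoly (2+ m) (+ 2+ p) k) (coeff-t-1*Dpoly (suc m) (+ suc p) k)) ⟩
  coeff (Dpoly (2+ m) (+ 2+ p)) k ℤ.+ coeff (t-1 *ₚ Dpoly (suc m) (+ suc p)) k
    ≡⟨ sym (coeff-+ₚ (Dpoly (2+ m) (+ 2+ p)) (t-1 *ₚ Dpoly (suc m) (+ suc p)) k) ⟩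
  coeff (Dpoly (2+ m) (+ 2+ p) +ₚ t-1 *ₚ Dpoly (suc m) (+ suc p)) k ∎
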